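{- A De Morgan clone $\mathsf C$ with $\mathsf{DMA}\subseteq\mathsf C$ is selfextensional if and only if $\mathsf C\subseteq\langle\mathsf{DMA},\partial\rangle$, i.e. if and only if every function in $\mathsf C$ is harmonious.
   Context: Let $\mathrm{DM}_4=\{\mathsf t,\mathsf f,\mathsf n,\mathsf b\}$, with truth order $\le$ ($\mathsf f$ least, $\mathsf t$ greatest, $\mathsf n,\mathsf b$ incomparable; meet $\wedge$, join $\vee$), De Morgan negation $-\mathsf t=\mathsf f$, $-\mathsf f=\mathsf t$, $-\mathsf n=\mathsf n$, $-\mathsf b=\mathsf b$, and conflation $\partial\mathsf t=\mathsf t$, $\partial\mathsf f=\mathsf f$, $\partial\mathsf n=\mathsf b$, $\partial\mathsf b=\mathsf n$. A De Morgan function is a map $\mathrm{DM}_4^n\to\mathrm{DM}_4$, $n\ge1$; a De Morgan clone is a set of such functions closed under composition and containing all projections; constants are unary constant functions. $\mathsf{DMA}$ is the clone generated by $\wedge,\vee,\mathsf t,\mathsf f,-$, and $\langle\mathsf{DMA},\partial\rangle$ the clone generated by $\mathsf{DMA}\cup\{\partial\}$. $f$ is harmonious if $f(\partial\overline a)=\partial f(\overline a)$ for all tuples $\overline a$. For sets $\Gamma(\overline x),\Theta(\overline x)\subseteq\mathsf C$, $\Gamma\vdash\Theta$ means: for every tuple $\overline a$ in $\mathrm{DM}_4$, $\Gamma(\overline a)\subseteq\{\mathsf t,\mathsf b\}$ implies $\Theta(\overline a)\subseteq\{\mathsf t,\mathsf b\}$; $\Gamma\dashv\vdash\Theta$ means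 both directions hold. $\mathsf C$ is selfextensional if for all $f,g,h\in\mathsf C$ with $f,g$ of the same arity, $f(\overline y)\dashv\vdash g(\overline y)$ implies $h(\overline x,f(\overline y),\overline z)\dashv\vdash h(\overline x,g(\overline y),\overline z)$. -}

module Defs where

open import Level using (Level; _⊔_) renaming (suc to lsuc; zero to lzero)
open import Data.Nat using (ℕ; zero; suc)
open import Data.Fin using (Fin; zero; suc)
open import Data.Sum using (_⊎_)
open import Data.Product using (_×_)
open import Data.Vec.Functional using (insertAt)
open import Relation.Binary.PropositionalEquality using (_≡_)

data DM4 : Set where
  t f n b : DM4

_∧_ : DM4 → DM4 → DM4
f ∧ _ = f
_ ∧ f = f
t ∧ y = y
x ∧ t = x
n ∧ n = n
b ∧ b = b
n ∧ b = f
b ∧ n = f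

_∨_ : DM4 → DM4 → DM4
t ∨ _ = t
_ ∨ t = t
f ∨ y = y
x ∨ f = x
n ∨ n = n
b ∨ b = b
n ∨ b = t
b ∨ n = t

-_ : DM4 → DM4
- t = f
- f = t
- n = n
- b = b

∂ : DM4 → DM4
∂ t = t
∂ f = f
∂ n = b
∂ b = n

-- Fn k : functions DM4^k → DM4.  De Morgan functions have arity ≥ 1,
-- so throughout, a family indexed by m talks about functions of arity (suc m).
Fn : ℕ → Set
Fn k = (Fin k → DM4) → DM4

FnFamily : (ℓ : Level) → Set (lsuc ℓ)
FnFamily ℓ = (m : ℕ) → Fn (suc m) → Set ℓ

-- Membership is also required to respect pointwise (extensional) equality of
-- functions, since a clone is a set of functions in the set-theoretic sense.
record IsDeMorganClone {ℓ : Level} (C : FnFamily ℓ) : Set ℓ where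
  field
    projections : ∀ (m : ℕ) (i : Fin (suc m)) → C m (λ a → a i)
    composition : ∀ {m k : ℕ} (g : Fn (suc m)) (hs : Fin (suc m) → Fn (suc k)) →
                  C m g → (∀ i → C k (hs i)) → C k (λ a → g (λ i → hs i a))
    extensional : ∀ {m : ℕ} (g h : Fn (suc m)) → (∀ a → g a ≡ h a) → C m g → C m h

data Generated (G : FnFamily lzero) : FnFamily lzero where
  gen  : ∀ {m} {g : Fn (suc m)} → G m g → Generated G m g
  proj : ∀ (m : ℕ) (i : Fin (suc m)) → Generated G m (λ a → a i)
  comp : ∀ {m k : ℕ} (g : Fn (suc m)) (hs : Fin (suc m) → Fn (suc k)) →
         Generated G m g → (∀ i → Generated G k (hs i)) →
         Generated G k (λ a → g (λ i → hs i a))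
  ext  : ∀ {m : ℕ} (g h : Fn (suc m)) → (∀ a → g a ≡ h a) →
         Generated G m g → Generated G m h

data DMAGens : FnFamily lzero where
  meetG : DMAGens 1 (λ a → a zero ∧ a (suc zero))
  joinG : DMAGens 1 (λ a → a zero ∨ a (suc zero))
  topG  : DMAGens 0 (λ _ → t)
  botG  : DMAGens 0 (λ _ → f)
  negG  : DMAGens 0 (λ a → - a zero)

data DMAConfGens : FnFamily lzero where
  dma  : ∀ {m} {g : Fn (suc m)} → DMAGens m g → DMAConfGens m g
  conf : DMAConfGens 0 (λ a → ∂ (a zero))

DMA : FnFamily lzero
DMA = Generated DMAGens

DMA∂ : FnFamily lzero
DMA∂ = Generated DMAConfGens

_⊆_ : ∀ {ℓ₁ ℓ₂} → FnFamily ℓ₁ → FnFamily ℓ₂ → Set (ℓ₁ ⊔ ℓ₂)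
C ⊆ D = ∀ (m : ℕ) (g : Fn (suc m)) → C m g → D m g

Designated : DM4 → Set
Designated x = (x ≡ t) ⊎ (x ≡ b)

harmonious : ∀ {k} → Fn k → Set
harmonious g = ∀ a → g (λ i → ∂ (a i)) ≡ ∂ (g a)

_⊣⊢_ : ∀ {V : Set} → ((V → DM4) → DM4) → ((V → DM4) → DM4) → Set
φ ⊣⊢ ψ = ∀ a → (Designated (φ a) → Designated (ψ a)) × (Designated (ψ a) → Designated (φ a))

-- h(x̄, g(ȳ), z̄): h of arity suc m, g of arity suc k, the g-argument placed at
-- position p; x̄ and z̄ together are xs, with variables distinct from ȳ.
-- Presented as a formula in the variables (xs , ys).
plug : ∀ {m k} → Fn (suc m) → Fin (suc m) → Fn (suc k) → ((Fin m ⊎ Fin (suc k)) → DM4) → DM4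
plug h p g a = h (insertAt (λ i → a (Data.Sum.inj₁ i)) p (g (λ j → a (Data.Sum.inj₂ j))))

Selfextensional : ∀ {ℓ} → FnFamily ℓ → Set ℓ
Selfextensional C =
  ∀ {k m : ℕ} (g g' : Fn (suc k)) (h : Fn (suc m)) →
  C k g → C k g' → C m h →
  g ⊣⊢ g' → ∀ (p : Fin (suc m)) → plug h p g ⊣⊢ plug h p g'

-- A value x ∈ DM4 is determined by whether x and ∂ x are designated, and also by whether x and
-- - x are designated.  The first fact makes interderivable harmonious functions equal, which
-- gives selfextensionality, and lets a disjunctive normal form over indicators of the four
-- values (which only reproduces designations) capture every harmonious function in ⟨DMA, ∂⟩.
-- The second fact makes interderivable members of a selfextensional clone C ⊇ DMA equal.
-- For g ∈ C and a tuple ā, replacing n by x and b by y in ā gives a binary u ∈ C with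
-- u(n, b) = g(ā) and u(b, n) = g(∂ ā), so it suffices that u(b, n) = ∂ u(n, b).  Let w ∈ DMA be
-- the binary function with w(b, n) = ∂ w(n, b) whose values at (n, b) and (b, n) have the same
-- designations as those of u.  The mask (z ∧ M(x, y)) ∨ N(x, y) returns z at (n, b) and (b, n)
-- and hides z elsewhere, so the masked u and w are interderivable, hence equal.
module Submission where

open import Defs
open import Level using (0ℓ)
open import Data.Bool using (Bool; true; false; if_then_else_) renaming (_≟_ to _≟ᵇ_)
open import Data.Bool.Properties using (⇔→≡)
open import Data.Nat using (ℕ; zero; suc)
open import Data.Fin using (Fin; zero; suc)
open import Data.Product using (Σ-syntax; _×_; _,_; proj₁; proj₂)
open import Data.Product.Properties using (≡-dec)
open import Data.Sum using (inj₁; inj₂; [_,_])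
open import Data.Vec.Functional using ([]; _∷_; tail; insertAt)
open import Function using (_∘_)
open import Function.Bundles using (_⇔_; mk⇔)
open import Relation.Binary.Definitions using (DecidableEquality)
open import Relation.Binary.PropositionalEquality using (_≡_; refl; sym; trans; cong; cong₂; _≗_; module ≡-Reasoning)
open import Relation.Nullary.Decidable using (Dec; map′; from-yes; _×-dec_; _→-dec_)
open import Relation.Unary using (Decidable)
open ≡-Reasoning

isDesignated : DM4 → Bool
isDesignated t = true
isDesignated b = true
isDesignated _ = false

Designated⇒isDesignated : ∀ {x} → Designated x → isDesignated x ≡ true
Designated⇒isDesignated (inj₁ refl) = refl
Designated⇒isDesignated (inj₂ refl) = refl

isDesignated⇒Designated : ∀ x → isDesignated x ≡ true → Designated x
isDesignated⇒Designated t _ = inj₁ refl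
isDesignated⇒Designated b _ = inj₂ refl
isDesignated⇒Designated f ()
isDesignated⇒Designated n ()

signature : DM4 → Bool × Bool
signature x = isDesignated x , isDesignated (∂ x)

fromSignature : Bool × Bool → DM4
fromSignature (true  , true ) = t
fromSignature (false , false) = f
fromSignature (false , true ) = n
fromSignature (true  , false) = b

fromSignature-signature : ∀ x → fromSignature (signature x) ≡ x
fromSignature-signature t = refl
fromSignature-signature f = refl
fromSignature-signature n = refl
fromSignature-signature b = refl

signature-fromSignature : ∀ s → signature (fromSignature s) ≡ s
signature-fromSignature (true  , true ) = refl
signature-fromSignature (false , false) = refl
signature-fromSignature (false , true ) = refl
signature-fromSignature (true  , false) = refl

signature-injective : ∀ {x y} → signature x ≡ signature y → x ≡ y
signature-injective {x} {y} eq = begin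
  x                           ≡⟨ fromSignature-signature x ⟨
  fromSignature (signature x) ≡⟨ cong fromSignature eq ⟩
  fromSignature (signature y) ≡⟨ fromSignature-signature y ⟩
  y                           ∎

infix 4 _≟_
_≟_ : DecidableEquality DM4
x ≟ y = map′ signature-injective (cong signature) (≡-dec _≟ᵇ_ _≟ᵇ_ (signature x) (signature y))

∀? : ∀ {p} {P : DM4 → Set p} → Decidable P → Dec (∀ x → P x)
∀? P? = map′ (λ { (pt , pf , pn , pb) → λ { t → pt ; f → pf ; n → pn ; b → pb } })
             (λ p → p t , p f , p n , p b)
             (P? t ×-dec P? f ×-dec P? n ×-dec P? b)

∂-injective : ∀ {x y} → ∂ x ≡ ∂ y → x ≡ y
∂-injective = from-yes (∀? λ x → ∀? λ y → ∂ x ≟ ∂ y →-dec x ≟ y) _ _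

∂-distrib-∧ : ∀ x y → ∂ (x ∧ y) ≡ ∂ x ∧ ∂ y
∂-distrib-∧ = from-yes (∀? λ x → ∀? λ y → ∂ (x ∧ y) ≟ ∂ x ∧ ∂ y)

∂-distrib-∨ : ∀ x y → ∂ (x ∨ y) ≡ ∂ x ∨ ∂ y
∂-distrib-∨ = from-yes (∀? λ x → ∀? λ y → ∂ (x ∨ y) ≟ ∂ x ∨ ∂ y)

∂-distrib-neg : ∀ x → ∂ (- x) ≡ - ∂ x
∂-distrib-neg = from-yes (∀? λ x → ∂ (- x) ≟ - ∂ x)

designated-with-neg-injective : ∀ x y → isDesignated x ≡ isDesignated y →
  isDesignated (- x) ≡ isDesignated (- y) → x ≡ y
designated-with-neg-injective = from-yes (∀? λ x → ∀? λ y →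
  isDesignated x ≟ᵇ isDesignated y →-dec isDesignated (- x) ≟ᵇ isDesignated (- y) →-dec x ≟ y)

⊣⊢⇒designation-≡ : ∀ {V : Set} {φ ψ : (V → DM4) → DM4} → φ ⊣⊢ ψ →
  ∀ a → isDesignated (φ a) ≡ isDesignated (ψ a)
⊣⊢⇒designation-≡ φ⊣⊢ψ a = ⇔→≡ (mk⇔ (transfer (proj₁ (φ⊣⊢ψ a))) (transfer (proj₂ (φ⊣⊢ψ a))))
  where
  transfer : ∀ {x y} → (Designated x → Designated y) → isDesignated x ≡ true → isDesignated y ≡ true
  transfer {x} x⇒y = Designated⇒isDesignated ∘ x⇒y ∘ isDesignated⇒Designated x

designation-≡⇒⊣⊢ : ∀ {V : Set} {φ ψ : (V → DM4) → DM4} →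
  (∀ a → isDesignated (φ a) ≡ isDesignated (ψ a)) → φ ⊣⊢ ψ
designation-≡⇒⊣⊢ eq a = transfer (eq a) , transfer (sym (eq a))
  where
  transfer : ∀ {x y} → isDesignated x ≡ isDesignated y → Designated x → Designated y
  transfer {y = y} eq′ = isDesignated⇒Designated y ∘ trans (sym eq′) ∘ Designated⇒isDesignated

≗⇒⊣⊢ : ∀ {V : Set} {φ ψ : (V → DM4) → DM4} → φ ≗ ψ → φ ⊣⊢ ψ
≗⇒⊣⊢ φ≗ψ = designation-≡⇒⊣⊢ (cong isDesignated ∘ φ≗ψ)

harmonious-≗ : ∀ {k} {g h : Fn k} → harmonious g → harmonious h →
  (∀ a → isDesignated (g a) ≡ isDesignated (h a)) → g ≗ h
harmonious-≗ {g = g} {h} g-harm h-harm eq a = signature-injective (cong₂ _,_ (eq a) (begin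
  isDesignated (∂ (g a))           ≡⟨ cong isDesignated (g-harm a) ⟨
  isDesignated (g (λ i → ∂ (a i))) ≡⟨ eq (λ i → ∂ (a i)) ⟩
  isDesignated (h (λ i → ∂ (a i))) ≡⟨ cong isDesignated (h-harm a) ⟩
  isDesignated (∂ (h a))           ∎))

-- Without function extensionality this is not automatic for a function on tuples.
Congruent : ∀ {k} {B : Set} → ((Fin k → DM4) → B) → Set
Congruent g = ∀ {a a′} → a ≗ a′ → g a ≡ g a′

module _ {G : FnFamily 0ℓ} (G-congruent : ∀ {m g} → G m g → Congruent g) where

  Generated-congruent : ∀ {m g} → Generated G m g → Congruent g
  Generated-congruent (gen g∈G)          = G-congruent g∈G
  Generated-congruent (proj m i)         a≗a′ = a≗a′ i
  Generated-congruent (comp g hs g∈ hs∈) a≗a′ =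
    Generated-congruent g∈ λ i → Generated-congruent (hs∈ i) a≗a′
  Generated-congruent (ext g h g≗h g∈) {a} {a′} a≗a′ = begin
    h a  ≡⟨ g≗h a ⟨
    g a  ≡⟨ Generated-congruent g∈ a≗a′ ⟩
    g a′ ≡⟨ g≗h a′ ⟩
    h a′ ∎

  Generated-harmonious : (∀ {m g} → G m g → harmonious g) → ∀ {m g} → Generated G m g → harmonious g
  Generated-harmonious G-harm (gen g∈G)          = G-harm g∈G
  Generated-harmonious G-harm (proj m i)         a = refl
  Generated-harmonious G-harm (comp g hs g∈ hs∈) a = begin
    g (λ i → hs i (λ j → ∂ (a j)))
      ≡⟨ Generated-congruent g∈ (λ i → Generated-harmonious G-harm (hs∈ i) a) ⟩
    g (λ i → ∂ (hs i a))
      ≡⟨ Generated-harmonious G-harm g∈ (λ i → hs i a) ⟩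
    ∂ (g (λ i → hs i a))
      ∎
  Generated-harmonious G-harm (ext g h g≗h g∈) a = begin
    h (λ i → ∂ (a i)) ≡⟨ g≗h _ ⟨
    g (λ i → ∂ (a i)) ≡⟨ Generated-harmonious G-harm g∈ a ⟩
    ∂ (g a)           ≡⟨ cong ∂ (g≗h a) ⟩
    ∂ (h a)           ∎

DMAConfGens-congruent : ∀ {m g} → DMAConfGens m g → Congruent g
DMAConfGens-congruent (dma meetG) a≗a′ = cong₂ _∧_ (a≗a′ zero) (a≗a′ (suc zero))
DMAConfGens-congruent (dma joinG) a≗a′ = cong₂ _∨_ (a≗a′ zero) (a≗a′ (suc zero))
DMAConfGens-congruent (dma topG)  a≗a′ = refl
DMAConfGens-congruent (dma botG)  a≗a′ = refl
DMAConfGens-congruent (dma negG)  a≗a′ = cong -_ (a≗a′ zero)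
DMAConfGens-congruent conf        a≗a′ = cong ∂ (a≗a′ zero)

DMAConfGens-harmonious : ∀ {m g} → DMAConfGens m g → harmonious g
DMAConfGens-harmonious (dma meetG) a = sym (∂-distrib-∧ (a zero) (a (suc zero)))
DMAConfGens-harmonious (dma joinG) a = sym (∂-distrib-∨ (a zero) (a (suc zero)))
DMAConfGens-harmonious (dma topG)  a = refl
DMAConfGens-harmonious (dma botG)  a = refl
DMAConfGens-harmonious (dma negG)  a = sym (∂-distrib-neg (a zero))
DMAConfGens-harmonious conf        a = refl

DMA∂-harmonious : ∀ {m g} → DMA∂ m g → harmonious g
DMA∂-harmonious = Generated-harmonious DMAConfGens-congruent DMAConfGens-harmonious

module Closure {G : FnFamily 0ℓ} (ι : ∀ {m g} → DMAGens m g → G m g) {k : ℕ} where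

  t-closed : Generated G k (λ _ → t)
  t-closed = comp (λ _ → t) (λ _ a → a zero) (gen (ι topG)) (λ _ → proj k zero)

  f-closed : Generated G k (λ _ → f)
  f-closed = comp (λ _ → f) (λ _ a → a zero) (gen (ι botG)) (λ _ → proj k zero)

  neg-closed : ∀ {g} → Generated G k g → Generated G k (λ a → - g a)
  neg-closed {g} g∈ = comp (λ a → - a zero) (λ _ → g) (gen (ι negG)) (λ _ → g∈)

  ∧-closed : ∀ {g h} → Generated G k g → Generated G k h → Generated G k (λ a → g a ∧ h a)
  ∧-closed {g} {h} g∈ h∈ =
    comp (λ a → a zero ∧ a (suc zero)) (g ∷ h ∷ []) (gen (ι meetG)) λ { zero → g∈ ; (suc zero) → h∈ }

  ∨-closed : ∀ {g h} → Generated G k g → Generated G k h → Generated G k (λ a → g a ∨ h a)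
  ∨-closed {g} {h} g∈ h∈ =
    comp (λ a → a zero ∨ a (suc zero)) (g ∷ h ∷ []) (gen (ι joinG)) λ { zero → g∈ ; (suc zero) → h∈ }

∂-closed : ∀ {k g} → DMA∂ k g → DMA∂ k (λ a → ∂ (g a))
∂-closed {g = g} g∈ = comp (λ a → ∂ (a zero)) (λ _ → g) (gen conf) (λ _ → g∈)

op₂ : (DM4 → DM4 → DM4) → Fn 2
op₂ U a = U (a zero) (a (suc zero))

-- v read as a binary term in which n and b are the two variables.
asBinaryTerm : DM4 → DM4 → DM4 → DM4
asBinaryTerm t x y = t
asBinaryTerm f x y = f
asBinaryTerm n x y = x
asBinaryTerm b x y = y

-- Equal to asBinaryTerm v when v ≡ v′, but by its clause order it computes to v at (n, b)
-- and to ∂ v′ at (b, n) even when v and v′ are unknown.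
asBinaryTerm′ : DM4 → DM4 → DM4 → DM4 → DM4
asBinaryTerm′ v v′ n b = v
asBinaryTerm′ v v′ b n = ∂ v′
asBinaryTerm′ t v′ x y = t
asBinaryTerm′ f v′ x y = f
asBinaryTerm′ n v′ x y = x
asBinaryTerm′ b v′ x y = y

asBinaryTerm′-diagonal : ∀ v x y → asBinaryTerm′ v v x y ≡ asBinaryTerm v x y
asBinaryTerm′-diagonal = from-yes (∀? λ v → ∀? λ x → ∀? λ y → asBinaryTerm′ v v x y ≟ asBinaryTerm v x y)

asBinaryTerm-∈ : ∀ v → DMA 1 (op₂ (asBinaryTerm v))
asBinaryTerm-∈ t = Closure.t-closed (λ g → g)
asBinaryTerm-∈ f = Closure.f-closed (λ g → g)
asBinaryTerm-∈ n = proj 1 zero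
asBinaryTerm-∈ b = proj 1 (suc zero)

asBinaryTerm′-∈ : ∀ {v v′} → v ≡ v′ → DMA 1 (op₂ (asBinaryTerm′ v v′))
asBinaryTerm′-∈ {v} refl =
  ext _ _ (λ a → sym (asBinaryTerm′-diagonal v (a zero) (a (suc zero)))) (asBinaryTerm-∈ v)

mask : DM4 → DM4 → DM4 → DM4
mask z x y = (z ∧ ((x ∧ (- x)) ∨ (y ∧ (- y)))) ∨ ((x ∨ (- x)) ∧ (y ∨ (- y)))

mask-nb : ∀ z → mask z n b ≡ z
mask-nb = from-yes (∀? λ z → mask z n b ≟ z)

mask-bn : ∀ z → mask z b n ≡ z
mask-bn = from-yes (∀? λ z → mask z b n ≟ z)

mask-hides : ∀ x y z z′ →
  (x ≡ n → y ≡ b → isDesignated z ≡ isDesignated z′) →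
  (x ≡ b → y ≡ n → isDesignated z ≡ isDesignated z′) →
  isDesignated (mask z x y) ≡ isDesignated (mask z′ x y)
mask-hides = from-yes (∀? λ x → ∀? λ y → ∀? λ z → ∀? λ z′ →
  (x ≟ n →-dec y ≟ b →-dec isDesignated z ≟ᵇ isDesignated z′) →-dec
  (x ≟ b →-dec y ≟ n →-dec isDesignated z ≟ᵇ isDesignated z′) →-dec
  isDesignated (mask z x y) ≟ᵇ isDesignated (mask z′ x y))

mask-∈ : DMA 2 (λ a → mask (a zero) (a (suc zero)) (a (suc (suc zero))))
mask-∈ = ∨-closed (∧-closed z (∨-closed (∧-closed x (neg-closed x)) (∧-closed y (neg-closed y))))
                  (∧-closed (∨-closed x (neg-closed x)) (∨-closed y (neg-closed y)))
  where
  open Closure (λ g → g)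
  z : DMA 2 (λ a → a zero)
  z = proj 2 zero
  x : DMA 2 (λ a → a (suc zero))
  x = proj 2 (suc zero)
  y : DMA 2 (λ a → a (suc (suc zero)))
  y = proj 2 (suc (suc zero))

masked : (DM4 → DM4 → DM4) → Fn 2
masked U = op₂ λ x y → mask (U x y) x y

masked-⊣⊢ : ∀ U V → isDesignated (U n b) ≡ isDesignated (V n b) →
  isDesignated (U b n) ≡ isDesignated (V b n) → masked U ⊣⊢ masked V
masked-⊣⊢ U V at-nb at-bn = designation-≡⇒⊣⊢ λ a → pointwise (a zero) (a (suc zero))
  where
  pointwise : ∀ x y → isDesignated (mask (U x y) x y) ≡ isDesignated (mask (V x y) x y)
  pointwise x y = mask-hides x y (U x y) (V x y) (λ { refl refl → at-nb }) (λ { refl refl → at-bn })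

-- χ v x is designated exactly when x ≡ v.
χ : DM4 → DM4 → DM4
χ t x = x ∧ ∂ x
χ f x = (- x) ∧ ∂ (- x)
χ n x = ∂ x ∧ ∂ (- x)
χ b x = x ∧ (- x)

select : DM4 → DM4 → DM4 → DM4 → DM4 → DM4
select t zt _  _  _  = zt
select f _  zf _  _  = zf
select n _  _  zn _  = zn
select b _  _  _  zb = zb

select-tabulate : ∀ x (z : DM4 → DM4) → select x (z t) (z f) (z n) (z b) ≡ z x
select-tabulate t z = refl
select-tabulate f z = refl
select-tabulate n z = refl
select-tabulate b z = refl

cases : DM4 → DM4 → DM4 → DM4 → DM4 → DM4
cases x zt zf zn zb = ((χ t x ∧ zt) ∨ (χ f x ∧ zf)) ∨ ((χ n x ∧ zn) ∨ (χ b x ∧ zb))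

cases-designated : ∀ x zt zf zn zb →
  isDesignated (cases x zt zf zn zb) ≡ isDesignated (select x zt zf zn zb)
cases-designated = from-yes (∀? λ x → ∀? λ zt → ∀? λ zf → ∀? λ zn → ∀? λ zb →
  isDesignated (cases x zt zf zn zb) ≟ᵇ isDesignated (select x zt zf zn zb))

splitFirst : ∀ {m} → (DM4 → Fn (suc m)) → Fn (suc m)
splitFirst W a = cases (a zero) (W t a) (W f a) (W n a) (W b a)

splitFirst-designated : ∀ {m} (W : DM4 → Fn (suc m)) a →
  isDesignated (splitFirst W a) ≡ isDesignated (W (a zero) a)
splitFirst-designated W a = begin
  isDesignated (splitFirst W a)
    ≡⟨ cases-designated (a zero) _ _ _ _ ⟩
  isDesignated (select (a zero) (W t a) (W f a) (W n a) (W b a))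
    ≡⟨ cong isDesignated (select-tabulate (a zero) (λ v → W v a)) ⟩
  isDesignated (W (a zero) a)
    ∎

splitFirst-∈ : ∀ {m} {W : DM4 → Fn (suc m)} → (∀ v → DMA∂ m (W v)) → DMA∂ m (splitFirst W)
splitFirst-∈ {m} W∈ = ∨-closed (∨-closed (∧-closed (χ∈ t) (W∈ t)) (∧-closed (χ∈ f) (W∈ f)))
                               (∨-closed (∧-closed (χ∈ n) (W∈ n)) (∧-closed (χ∈ b) (W∈ b)))
  where
  open Closure dma
  x : DMA∂ m (λ a → a zero)
  x = proj m zero
  χ∈ : ∀ v → DMA∂ m (λ a → χ v (a zero))
  χ∈ t = ∧-closed x (∂-closed x)
  χ∈ f = ∧-closed (neg-closed x) (∂-closed (neg-closed x))
  χ∈ n = ∧-closed (∂-closed x) (∂-closed (neg-closed x))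
  χ∈ b = ∧-closed x (neg-closed x)

constant-∈ : ∀ {m} β → DMA∂ m (λ _ → if β then t else f)
constant-∈ true  = Closure.t-closed dma
constant-∈ false = Closure.f-closed dma

constant-designated : ∀ β → isDesignated (if β then t else f) ≡ β
constant-designated true  = refl
constant-designated false = refl

realise : ∀ m (φ : (Fin (suc m) → DM4) → Bool) → Congruent φ →
  Σ[ E ∈ Fn (suc m) ] DMA∂ m E × (∀ a → isDesignated (E a) ≡ φ a)
realise zero φ φ-cong = splitFirst W , splitFirst-∈ (λ v → constant-∈ (φ (λ _ → v))) , λ a → begin
  isDesignated (splitFirst W a) ≡⟨ splitFirst-designated W a ⟩
  isDesignated (W (a zero) a)   ≡⟨ constant-designated _ ⟩
  φ (λ _ → a zero)              ≡⟨ φ-cong (λ { zero → refl }) ⟩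
  φ a                           ∎
  where
  W : DM4 → Fn 1
  W v _ = if φ (λ _ → v) then t else f
realise (suc m) φ φ-cong = splitFirst W , splitFirst-∈ W∈ , λ a → begin
  isDesignated (splitFirst W a) ≡⟨ splitFirst-designated W a ⟩
  isDesignated (W (a zero) a)   ≡⟨ proj₂ (proj₂ (rest (a zero))) (tail a) ⟩
  φ (a zero ∷ tail a)           ≡⟨ φ-cong (λ { zero → refl ; (suc i) → refl }) ⟩
  φ a                           ∎
  where
  rest : ∀ v → Σ[ E ∈ Fn (suc m) ] DMA∂ m E × (∀ a → isDesignated (E a) ≡ φ (v ∷ a))
  rest v = realise m (λ a → φ (v ∷ a)) (λ a≗a′ → φ-cong λ { zero → refl ; (suc i) → a≗a′ i })
  W : DM4 → Fn (suc (suc m))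
  W v a = proj₁ (rest v) (tail a)
  W∈ : ∀ v → DMA∂ (suc m) (W v)
  W∈ v = comp (proj₁ (rest v)) (λ i a → a (suc i)) (proj₁ (proj₂ (rest v))) (λ i → proj (suc m) (suc i))

AllHarmonious : ∀ {ℓ} → FnFamily ℓ → Set ℓ
AllHarmonious C = ∀ (m : ℕ) (g : Fn (suc m)) → C m g → harmonious g

BinaryHarmonious : ∀ {ℓ} → FnFamily ℓ → Set ℓ
BinaryHarmonious C = ∀ (U : DM4 → DM4 → DM4) → C 1 (op₂ U) → U b n ≡ ∂ (U n b)

harmonious⇒selfextensional : ∀ {ℓ} (C : FnFamily ℓ) → AllHarmonious C → Selfextensional C
harmonious⇒selfextensional C harm g g′ h g∈ g′∈ _ g⊣⊢g′ p = ≗⇒⊣⊢ λ α →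
  cong (λ v → h (insertAt (λ i → α (inj₁ i)) p v))
       (harmonious-≗ (harm _ g g∈) (harm _ g′ g′∈) (⊣⊢⇒designation-≡ g⊣⊢g′) (λ j → α (inj₂ j)))

⊆DMA∂⇒harmonious : ∀ {ℓ} (C : FnFamily ℓ) → C ⊆ DMA∂ → AllHarmonious C
⊆DMA∂⇒harmonious C C⊆DMA∂ m g g∈ = DMA∂-harmonious (C⊆DMA∂ m g g∈)

module _ {ℓ} {C : FnFamily ℓ} (clone : IsDeMorganClone C) (DMA⊆C : DMA ⊆ C) where
  open IsDeMorganClone clone

  private
    DMA-∈ : ∀ {m g} → DMA m g → C m g
    DMA-∈ = DMA⊆C _ _

  selfextensional⇒≗ : Selfextensional C → ∀ {k} {g g′ : Fn (suc k)} →
    C k g → C k g′ → g ⊣⊢ g′ → g ≗ g′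
  selfextensional⇒≗ se {g = g} {g′} g∈ g′∈ g⊣⊢g′ a =
    designated-with-neg-injective (g a) (g′ a) (⊣⊢⇒designation-≡ g⊣⊢g′ a)
      (⊣⊢⇒designation-≡ neg-g⊣⊢neg-g′ [ (λ ()) , a ])
    where
    -- h is negation, with no arguments besides g(ȳ); hence the assignment [ (λ ()) , a ].
    neg-g⊣⊢neg-g′ : plug (λ x → - x zero) zero g ⊣⊢ plug (λ x → - x zero) zero g′
    neg-g⊣⊢neg-g′ = se g g′ (λ x → - x zero) g∈ g′∈ (DMA-∈ (gen negG)) g⊣⊢g′ zero

  masked-∈ : ∀ U → C 1 (op₂ U) → C 1 (masked U)
  masked-∈ U U∈ = composition _ (op₂ U ∷ (λ a → a zero) ∷ (λ a → a (suc zero)) ∷ []) (DMA-∈ mask-∈)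
    λ { zero → U∈ ; (suc zero) → projections 1 zero ; (suc (suc zero)) → projections 1 (suc zero) }

  selfextensional⇒binary-harmonious : Selfextensional C → BinaryHarmonious C
  selfextensional⇒binary-harmonious se U U∈ = begin
    U b n                 ≡⟨ mask-bn (U b n) ⟨
    masked U (b ∷ n ∷ []) ≡⟨ masked-U≗V (b ∷ n ∷ []) ⟩
    masked V (b ∷ n ∷ []) ≡⟨ mask-bn (∂ v) ⟩
    ∂ v                   ≡⟨ cong ∂ v≡Unb ⟩
    ∂ (U n b)             ∎
    where
    v : DM4
    v = fromSignature (isDesignated (U n b) , isDesignated (U b n))
    V : DM4 → DM4 → DM4
    V = asBinaryTerm′ v v
    masked-U≗V : masked U ≗ masked V
    masked-U≗V = selfextensional⇒≗ se (masked-∈ U U∈) (masked-∈ V (DMA-∈ (asBinaryTerm′-∈ refl)))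
      (masked-⊣⊢ U V (sym (cong proj₁ (signature-fromSignature _)))
                     (sym (cong proj₂ (signature-fromSignature _))))
    v≡Unb : v ≡ U n b
    v≡Unb = begin
      v                     ≡⟨ mask-nb v ⟨
      masked V (n ∷ b ∷ []) ≡⟨ masked-U≗V (n ∷ b ∷ []) ⟨
      masked U (n ∷ b ∷ []) ≡⟨ mask-nb (U n b) ⟩
      U n b                 ∎

  binary-harmonious⇒harmonious : BinaryHarmonious C → AllHarmonious C
  binary-harmonious⇒harmonious bh m g g∈ a =
    bh (λ x y → g (λ i → asBinaryTerm′ (a i) (a i) x y))
       (composition g (λ i → op₂ (asBinaryTerm′ (a i) (a i))) g∈ (λ i → DMA-∈ (asBinaryTerm′-∈ refl)))

  binary-harmonious⇒congruent : BinaryHarmonious C → ∀ {m g} → C m g → Congruent g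
  binary-harmonious⇒congruent bh {m} {g} g∈ {a} {a′} a≗a′ = ∂-injective (begin
    ∂ (g a)            ≡⟨ bh U U∈ ⟨
    g (λ i → ∂ (a′ i)) ≡⟨ binary-harmonious⇒harmonious bh m g g∈ a′ ⟩
    ∂ (g a′)           ∎)
    where
    U : DM4 → DM4 → DM4
    U x y = g (λ i → asBinaryTerm′ (a i) (a′ i) x y)
    U∈ : C 1 (op₂ U)
    U∈ = composition g (λ i → op₂ (asBinaryTerm′ (a i) (a′ i))) g∈ (λ i → DMA-∈ (asBinaryTerm′-∈ (a≗a′ i)))

  binary-harmonious⇒⊆DMA∂ : BinaryHarmonious C → C ⊆ DMA∂
  binary-harmonious⇒⊆DMA∂ bh m g g∈
    with realise m (isDesignated ∘ g) (cong isDesignated ∘ binary-harmonious⇒congruent bh g∈)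
  ... | E , E∈ , E≡g = ext E g E≗g E∈
    where
    E≗g : E ≗ g
    E≗g = harmonious-≗ (DMA∂-harmonious E∈) (binary-harmonious⇒harmonious bh m g g∈) E≡g

mainTheorem17 : ∀ {ℓ} (C : FnFamily ℓ) → IsDeMorganClone C → DMA ⊆ C →
    (Selfextensional C ⇔ (C ⊆ DMA∂))
    × (Selfextensional C ⇔ (∀ (m : ℕ) (g : Fn (suc m)) → C m g → harmonious g))
mainTheorem17 C clone DMA⊆C =
  mk⇔ (binary-harmonious⇒⊆DMA∂ clone DMA⊆C ∘ se⇒bh)
      (harmonious⇒selfextensional C ∘ ⊆DMA∂⇒harmonious C) ,
  mk⇔ (binary-harmonious⇒harmonious clone DMA⊆C ∘ se⇒bh)
      (harmonious⇒selfextensional C)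
  where
  se⇒bh : Selfextensional C → BinaryHarmonious C
  se⇒bh = selfextensional⇒binary-harmonious clone DMA⊆C
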